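{- Let $k\ge r\ge3$, $p,t\ge0$, $N_2\geq 0$, and let $\pi\in\mathbb{C}_{<}(k,r|p,t)$ be such that exactly $N_2$ parts are marked with $2$ in $GG(\pi)$. Then $p+t\geq N_2$.
   Context: A partition is a finite non-increasing sequence of positive integers. $\mathbb{C}(k,r)$ is the set of partitions $\pi=(\pi_1,\dots,\pi_\ell)$ with no repeated odd part, $\pi_i\ge\pi_{i+k-1}+2$ for $1\le i\le\ell-k+1$ (strict if $\pi_i$ even), and at most $r-1$ parts $\le2$. Göllnitz–Gordon marking $GG(\pi)$: marks (positive integers) are assigned to the parts from smallest to largest, each as small as possible subject to: the mark of $\pi_i$ differs from the marks of all parts $\pi_g$, $g>i$, with $\pi_i-\pi_g\le2$ (strict if $\pi_i$ odd). A "$j$-marked $x$" is a part $x$ with mark $j$. $N_j$ is the number of $j$-marked parts and $\pi^{(j)}_1>\cdots>\pi^{(j)}_{N_j}$ are these parts; $\pi^{(j)}_0=+\infty$, $\pi^{(j)}_{N_j+1}=-\infty$. Starting types (for $N_2\ge1$): let $l$ be the largest integer $0\le l\le N_2$ such that no odd part of $\pi$ is $\ge\pi^{(2)}_l$; parts $\pi^{(2)}_i$, $i>l$, are of type $s_{ -1}$. For $b=1$: $\pi^{(2)}_1$ is of type $s_0$ [resp. $s_1$] with $s_1(\pi)=\pi^{(2)}_1-1$ [resp. $-2$] if there is a 1-marked $\pi^{(2)}_1-1$ [resp. $\pi^{(2)}_1-2$] and $\pi^{(2)}_1+2$ does not occur; of type $s_2$ ($s_1(\pi)=\pi^{(2)}_1+2$)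 if there is a 1-marked $\pi^{(2)}_1+2$; of type $s_3$ ($s_1(\pi)=\pi^{(2)}_1$) if there is a 1-marked $\pi^{(2)}_1$. For $b=2,\dots,l$: type $s_0$ [resp. $s_1$], $s_b(\pi)=\pi^{(2)}_b-1$ [resp. $-2$], if there is a 1-marked $\pi^{(2)}_b-1$ [resp. $-2$] and, whenever a 1-marked $\pi^{(2)}_b+2$ exists, $s_{b-1}(\pi)=\pi^{(2)}_b+2$; type $s_2$ ($s_b(\pi)=\pi^{(2)}_b+2$) if there is a 1-marked $\pi^{(2)}_b+2$ and $s_{b-1}(\pi)\neq\pi^{(2)}_b+2$; type $s_3$ ($s_b(\pi)=\pi^{(2)}_b$) if there is a 1-marked $\pi^{(2)}_b$. $\mathbb{C}_{<}(k,r|p,t)$ is the set of $\pi\in\mathbb{C}(k,r)$ such that: (1) no odd part is $\ge2t+1$; (2) $\pi^{(2)}_{p+1}<2t+1<\pi^{(2)}_p$; (3) if $\pi^{(2)}_p=2t+2$ it is of starting type $s_2$ or $s_3$; (4) if $\pi^{(2)}_{p+1}=2t$ it is of starting type $s_0$ or $s_1$. -}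

module Defs where

open import Data.Nat using (ℕ; zero; suc; _+_; _*_; _∸_; _≤_; _<_; _≥_; _>_; _%_; _≡ᵇ_; _≤ᵇ_; _<ᵇ_)
open import Data.Bool using (Bool; true; false; if_then_else_; _∧_)
open import Data.List using (List; []; _∷_; length; map)
open import Data.Bool.ListAction using (any)
open import Data.List.Membership.Propositional using (_∈_)
open import Data.List.Relation.Unary.All using (All)
open import Data.List.Relation.Unary.Linked using (Linked)
open import Data.Maybe using (Maybe; just; nothing)
open import Data.Product using (Σ; _×_; _,_; proj₁; ∃)
open import Data.Sum using (_⊎_)
open import Data.Empty using (⊥)
open import Data.Unit using (⊤)
open import Relation.Binary.PropositionalEquality using (_≡_)
open import Relation.Nullary using (¬_)

IsOdd : ℕ → Set
IsOdd n = n % 2 ≡ 1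

IsEven : ℕ → Set
IsEven n = n % 2 ≡ 0

isOddᵇ : ℕ → Bool
isOddᵇ n = (n % 2) ≡ᵇ 1

IsPartition : List ℕ → Set
IsPartition π = All (λ x → 1 ≤ x) π × Linked _≥_ π

-- 0-based lookup: at xs i = x_{i+1}
at : {A : Set} → List A → ℕ → Maybe A
at [] _ = nothing
at (x ∷ xs) zero = just x
at (x ∷ xs) (suc i) = at xs i

filterᵇ : {A : Set} → (A → Bool) → List A → List A
filterᵇ p [] = []
filterᵇ p (x ∷ xs) = if p x then x ∷ filterᵇ p xs else filterᵇ p xs

count : ℕ → List ℕ → ℕ
count x π = length (filterᵇ (λ y → y ≡ᵇ x) π)

InC : ℕ → ℕ → List ℕ → Set
InC k r π =
  IsPartition π
  × (∀ x → IsOdd x → count x π ≤ 1)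
  × (∀ i x y → at π i ≡ just x → at π (i + (k ∸ 1)) ≡ just y →
       (y + 2 ≤ x) × (IsEven x → y + 2 < x))
  × (length (filterᵇ (λ y → y ≤ᵇ 2) π) ≤ r ∸ 1)

-- smallest positive integer not in the list (fuel = length suffices)
mexFrom : ℕ → ℕ → List ℕ → ℕ
mexFrom zero c l = c
mexFrom (suc f) c l = if any (λ y → y ≡ᵇ c) l then mexFrom f (suc c) l else c

mex : List ℕ → ℕ
mex l = mexFrom (length l) 1 l

-- "π_i - π_g ≤ 2 (strict if π_i odd)", for π_i = x ≥ π_g = y
closeᵇ : ℕ → ℕ → Bool
closeᵇ x y = if isOddᵇ x then (x ∸ y) <ᵇ 2 else (x ∸ y) ≤ᵇ 2

-- marked parts, in the order of π (parts paired with their marks);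
-- the marks of the smaller parts (the tail) are assigned first.
GG : List ℕ → List (ℕ × ℕ)
GG [] = []
GG (x ∷ xs) =
  let rest = GG xs in
  (x , mex (map proj₁' (filterᵇ (λ pm → closeᵇ x (fst' pm)) rest))) ∷ rest
  where
  fst' : ℕ × ℕ → ℕ
  fst' (a , _) = a
  proj₁' : ℕ × ℕ → ℕ
  proj₁' (_ , m) = m

marked : ℕ → List ℕ → List ℕ
marked j π = map proj₁ (filterᵇ (λ pm → Data.Product.proj₂ pm ≡ᵇ j) (GG π))

N : ℕ → List ℕ → ℕ
N j π = length (marked j π)

OneMarked : List ℕ → ℕ → Set
OneMarked π v = (v , 1) ∈ GG π

-- l' satisfies the defining condition of l: 0 ≤ l' ≤ N₂ and no odd part
-- of π is ≥ π^{(2)}_{l'}  (π^{(2)}_0 = +∞)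
GoodL : List ℕ → ℕ → Set
GoodL π zero = ⊤
GoodL π (suc l') = l' < N 2 π ×
  Σ ℕ λ x → at (marked 2 π) l' ≡ just x × (∀ y → y ∈ π → IsOdd y → y < x)

-- b ≤ l, where l is the largest integer satisfying GoodL
WithinL : List ℕ → ℕ → Set
WithinL π b = Σ ℕ λ l' → GoodL π l' × b ≤ l'

data SType : Set where
  s0 s1 s2 s3 : SType

sval : SType → ℕ → ℕ
sval s0 x = x ∸ 1
sval s1 x = x ∸ 2
sval s2 x = x + 2
sval s3 x = x

mutual
  -- HasType π b τ : π^{(2)}_b (1 ≤ b ≤ l) is of starting type τ
  HasType : List ℕ → ℕ → SType → Set
  HasType π zero τ = ⊥
  HasType π (suc b) τ =
    WithinL π (suc b) × Σ ℕ λ x → at (marked 2 π) b ≡ just x × Cond π b x τ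

  -- condition for π^{(2)}_{b+1} = x to be of type τ
  Cond : List ℕ → ℕ → ℕ → SType → Set
  Cond π zero x s0 = OneMarked π (x ∸ 1) × ¬ ((x + 2) ∈ π)
  Cond π zero x s1 = OneMarked π (x ∸ 2) × ¬ ((x + 2) ∈ π)
  Cond π zero x s2 = OneMarked π (x + 2)
  Cond π zero x s3 = OneMarked π x
  Cond π (suc b) x s0 = OneMarked π (x ∸ 1) × (OneMarked π (x + 2) → SVal π (suc b) (x + 2))
  Cond π (suc b) x s1 = OneMarked π (x ∸ 2) × (OneMarked π (x + 2) → SVal π (suc b) (x + 2))
  Cond π (suc b) x s2 = OneMarked π (x + 2) × ¬ SVal π (suc b) (x + 2)
  Cond π (suc b) x s3 = OneMarked π x

  SVal : List ℕ → ℕ → ℕ → Set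
  SVal π b v = Σ SType λ τ → HasType π b τ ×
    Σ ℕ λ x → at (marked 2 π) (b ∸ 1) ≡ just x × sval τ x ≡ v

InC< : ℕ → ℕ → ℕ → ℕ → List ℕ → Set
InC< k r p t π =
  InC k r π
  × (∀ y → y ∈ π → IsOdd y → y < 2 * t + 1)
  -- (2a) 2t+1 < π^{(2)}_p   (π^{(2)}_0 = +∞, π^{(2)}_j = -∞ for j > N₂)
  × Above p
  × (∀ x → at (marked 2 π) p ≡ just x → x < 2 * t + 1)
  × (∀ q x → p ≡ suc q → at (marked 2 π) q ≡ just x → x ≡ 2 * t + 2 →
       HasType π p s2 ⊎ HasType π p s3)
  × (∀ x → at (marked 2 π) p ≡ just x → x ≡ 2 * t →
       HasType π (suc p) s0 ⊎ HasType π (suc p) s1)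
  where
  Above : ℕ → Set
  Above zero = ⊤
  Above (suc q) = Σ ℕ λ x → at (marked 2 π) q ≡ just x × 2 * t + 1 < x

module Submission where

open import Defs
open import Data.Nat using (ℕ; zero; suc; _+_; _*_; _≤_; _<_; _≥_; z≤n; s≤s; _∸_; _≡ᵇ_; _<ᵇ_; _≤ᵇ_)
open import Data.Nat.Properties
  using (≡⇒≡ᵇ; ≡ᵇ⇒≡; n≮n; +-identityʳ; +-suc; ≤-<-trans; +-monoˡ-≤; +-cancelʳ-<; *-cancelˡ-<; module ≤-Reasoning)
open import Data.Nat.Tactic.RingSolver using (solve-∀)
open import Data.Bool using (true; false; T; if_then_else_)
open import Data.Bool.ListAction using (any)
open import Data.List using (List; []; _∷_; length; map)
open import Data.List.Relation.Unary.All using (All; []; _∷_)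
import Data.List.Relation.Unary.All as All
open import Data.List.Relation.Unary.AllPairs using (AllPairs; []; _∷_)
open import Data.List.Relation.Unary.Linked using (Linked; _∷_)
import Data.List.Relation.Unary.Linked as Linked
open import Data.List.Relation.Unary.Linked.Properties using (AllPairs⇒Linked)
open import Data.Maybe using (just)
open import Data.Product using (_×_; _,_; proj₁; proj₂)
open import Data.Empty using (⊥-elim)
open import Function using (case_of_; _$_)
open import Relation.Binary.PropositionalEquality using (_≡_; refl; sym; subst)

-- When GG gives a part x the mark 2, no smaller part close to x carries the mark 2, and
-- every part that is not close to x lies at least 2 below it.  Hence the 2-marked parts
-- form a positive sequence with gaps ≥ 2; condition (2) puts all but the first p of them
-- below 2t+1, and there is room for at most t such parts.  Only (2) and the positivity
-- of the parts are used.

mexFrom-absent : ∀ f c l → mexFrom f c l < c + f → any (_≡ᵇ mexFrom f c l) l ≡ false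
mexFrom-absent zero c l h = ⊥-elim (n≮n c (subst (c <_) (+-identityʳ c) h))
mexFrom-absent (suc f) c l h with any (_≡ᵇ c) l in c-absent
... | true = mexFrom-absent f (suc c) l (subst (mexFrom f (suc c) l <_) (+-suc c f) h)
... | false = c-absent

-- Only for singletons can mex l reach 1 + length l, beyond the reach of mexFrom-absent.
mex≡2⇒2∉ : ∀ l → mex l ≡ 2 → any (_≡ᵇ 2) l ≡ false
mex≡2⇒2∉ [] _ = refl
mex≡2⇒2∉ (0 ∷ []) ()
mex≡2⇒2∉ (1 ∷ []) _ = refl
mex≡2⇒2∉ (2 ∷ []) ()
mex≡2⇒2∉ (suc (suc (suc _)) ∷ []) ()
mex≡2⇒2∉ l@(_ ∷ _ ∷ l′) mex≡2 =
  subst (λ m → any (_≡ᵇ m) l ≡ false) mex≡2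
    (mexFrom-absent (length l) 1 l (subst (_< 3 + length l′) (sym mex≡2) (s≤s (s≤s (s≤s z≤n)))))

≡ᵇ-true⇒≡ : ∀ {m n} → (m ≡ᵇ n) ≡ true → m ≡ n
≡ᵇ-true⇒≡ {m} {n} m≡ᵇn = ≡ᵇ⇒≡ m n (subst T (sym m≡ᵇn) _)

Apart : ℕ → ℕ → Set
Apart a b = b + 2 ≤ a

2≤m∸n⇒n+2≤m : ∀ m n → 2 ≤ m ∸ n → n + 2 ≤ m
2≤m∸n⇒n+2≤m m zero h = h
2≤m∸n⇒n+2≤m (suc m) (suc n) h = s≤s (2≤m∸n⇒n+2≤m m n h)

unclose⇒2≤ : ∀ odd d → (if odd then d <ᵇ 2 else d ≤ᵇ 2) ≡ false → 2 ≤ d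
unclose⇒2≤ _ (suc (suc _)) _ = s≤s (s≤s z≤n)
unclose⇒2≤ true zero ()
unclose⇒2≤ true (suc zero) ()
unclose⇒2≤ false zero ()
unclose⇒2≤ false (suc zero) ()

unclose⇒Apart : ∀ x b → closeᵇ x b ≡ false → Apart x b
unclose⇒Apart x b unclose = 2≤m∸n⇒n+2≤m x b (unclose⇒2≤ (isOddᵇ x) (x ∸ b) unclose)

closeMarks : ℕ → List (ℕ × ℕ) → List ℕ
closeMarks x G = map proj₂ (filterᵇ (λ pm → closeᵇ x (proj₁ pm)) G)

withMark : ℕ → List (ℕ × ℕ) → List ℕ
withMark j G = map proj₁ (filterᵇ (λ pm → proj₂ pm ≡ᵇ j) G)

IfMarked : ℕ → (ℕ → Set) → ℕ × ℕ → Set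
IfMarked j P (b , m) = m ≡ j → P b

BothMarked : ℕ → (ℕ → ℕ → Set) → ℕ × ℕ → ℕ × ℕ → Set
BothMarked j R (a , m) bm = m ≡ j → IfMarked j (R a) bm

GG-All : ∀ {P : ℕ → Set} π → All P π → All (λ pm → P (proj₁ pm)) (GG π)
GG-All [] [] = []
GG-All (x ∷ xs) (px ∷ pxs) = px ∷ GG-All xs pxs

withMark-All : ∀ j {P : ℕ → Set} G → All (IfMarked j P) G → All P (withMark j G)
withMark-All j [] [] = []
withMark-All j ((b , m) ∷ G) (pb ∷ pG) with m ≡ᵇ j in m≡ᵇj
... | true = pb (≡ᵇ-true⇒≡ m≡ᵇj) ∷ withMark-All j G pG
... | false = withMark-All j G pG

withMark-AllPairs : ∀ j {R : ℕ → ℕ → Set} G → AllPairs (BothMarked j R) G → AllPairs R (withMark j G)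
withMark-AllPairs j [] [] = []
withMark-AllPairs j ((a , m) ∷ G) (ra ∷ rG) with m ≡ᵇ j in m≡ᵇj
... | true = withMark-All j G (All.map (_$ ≡ᵇ-true⇒≡ m≡ᵇj) ra) ∷ withMark-AllPairs j G rG
... | false = withMark-AllPairs j G rG

marked-All : ∀ {P : ℕ → Set} j π → All P π → All P (marked j π)
marked-All j π pπ = withMark-All j (GG π) (All.map (λ p _ → p) (GG-All π pπ))

unclose⇒BothMarked : ∀ j x m G →
  (m ≡ j → any (_≡ᵇ j) (closeMarks x G) ≡ false) →
  All (BothMarked j Apart (x , m)) G
unclose⇒BothMarked j x m [] _ = []
unclose⇒BothMarked j x m ((b , m′) ∷ G) h with closeᵇ x b in unclose
... | false = (λ _ _ → unclose⇒Apart x b unclose) ∷ unclose⇒BothMarked j x m G h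
... | true with m′ ≡ᵇ j in m′≡ᵇj
...   | true = (λ m≡j → case h m≡j of λ ()) ∷ unclose⇒BothMarked j x m G (λ m≡j → case h m≡j of λ ())
...   | false = (λ _ m′≡j → ⊥-elim (subst T m′≡ᵇj (≡⇒≡ᵇ m′ j m′≡j))) ∷ unclose⇒BothMarked j x m G h

GG-2-apart : ∀ π → AllPairs (BothMarked 2 Apart) (GG π)
GG-2-apart [] = []
GG-2-apart (x ∷ xs) = unclose⇒BothMarked 2 x _ (GG xs) (mex≡2⇒2∉ (closeMarks x (GG xs))) ∷ GG-2-apart xs

marked-2-apart : ∀ π → AllPairs Apart (marked 2 π)
marked-2-apart π = withMark-AllPairs 2 (GG π) (GG-2-apart π)

apart-head-bound : ∀ y L → Linked Apart (y ∷ L) → All (1 ≤_) (y ∷ L) → 2 * length L + 1 ≤ y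
apart-head-bound y [] _ (1≤y ∷ _) = 1≤y
apart-head-bound y (z ∷ L) (z+2≤y ∷ apart) (_ ∷ positive) = begin
  2 * suc (length L) + 1   ≡⟨ two-more (length L) ⟩
  (2 * length L + 1) + 2   ≤⟨ +-monoˡ-≤ 2 (apart-head-bound z L apart positive) ⟩
  z + 2                    ≤⟨ z+2≤y ⟩
  y                        ∎
  where
  open ≤-Reasoning
  two-more : ∀ n → 2 * suc n + 1 ≡ (2 * n + 1) + 2
  two-more = solve-∀

apart-length≤ : ∀ p t L → Linked Apart L → All (1 ≤_) L →
  (∀ x → at L p ≡ just x → x < 2 * t + 1) → length L ≤ p + t
apart-length≤ _ _ [] _ _ _ = z≤n
apart-length≤ zero t (y ∷ L) apart positive below =
  *-cancelˡ-< 2 (length L) t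
    (+-cancelʳ-< 1 (2 * length L) (2 * t) (≤-<-trans (apart-head-bound y L apart positive) (below y refl)))
apart-length≤ (suc p) t (_ ∷ L) apart (_ ∷ positive) below =
  s≤s (apart-length≤ p t L (Linked.tail apart) positive below)

proposition2p3 : (k r p t N₂ : ℕ) (π : List ℕ) → 3 ≤ r → r ≤ k →
    InC< k r p t π → N 2 π ≡ N₂ → p + t ≥ N₂
proposition2p3 _ _ p t _ π _ _ (((positive , _) , _) , _ , _ , below , _) refl =
  apart-length≤ p t (marked 2 π) (AllPairs⇒Linked (marked-2-apart π)) (marked-All 2 π positive) below
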